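{- Let $H$ be a graph and let $(G,L)$ be an instance of $\textsc{LHom}(H)$. Applying any one of the reduction rules (R1)–(R6) to $(G,L)$ yields an equivalent instance: if the rule returns NO, then $(G,L)$ is a no-instance, and otherwise the resulting instance is a yes-instance if and only if $(G,L)$ is a yes-instance.
   Context: All graphs are finite and simple. In $\textsc{LHom}(H)$ the input is a graph $G$ with lists $L: V(G)\to 2^{V(H)}$ and the question is whether there is $\varphi: V(G)\to V(H)$ with $\varphi(v)\in L(v)$ for all $v$ and $\varphi(u)\varphi(v)\in E(H)$ for all $uv\in E(G)$. When $H=C_{2k+1}$, its vertex set is $\{0,1,\ldots,2k\}$ with $i$ adjacent to $i\pm1$, arithmetic modulo $2k+1$. Identifying vertices of $G$ means replacing them by a single vertex adjacent to the union of their neighbourhoods. The reduction rules are: (R1) If $H=C_{2k+1}$ and $G$ contains an odd cycle of length at most $2k-1$, return NO. (R2) If $H=C_{2k+1}$ and $G$ contains two $(2k+1)$-cycles with consecutive vertices $c_0,\ldots,c_{2k}$ and $c'_0,\ldots,c'_{2k}$ such that $c_0=c'_0$ and $c_i=c'_j$ for some $i,j\neq 0$, then (a) if $i=j$, identify $c_\ell$ with $c'_\ell$ for every $\ell\in\{1,\ldots,2k\}$; (b) if $i=-j$ (mod $2k+1$), identify $c_\ell$ with $c'_{ -\ell}$ for every $\ell$; (c) otherwise return NO. (R3) For every edge $uv\in E(G)$, if there is $x\in L(u)$ with $N_H(x)\cap L(v)=\emptyset$, remove $x$ from $L(u)$. (R4) If some $v\in V(G)$ has $L(v)=\emptyset$,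 return NO. (R5) For $v\in V(G)$, if there are distinct $x,y\in L(v)$ such that for every $u\in N_G(v)$ we have $N_H(x)\cap L(u)\subseteq N_H(y)\cap L(u)$, remove $x$ from $L(v)$. (R6) For $x\in V(H)$ and distinct $u,v\in V(G)$ with $L(u)=L(v)=\{x\}$: if $uv\in E(G)$ return NO, otherwise identify $u$ with $v$. -}

module Defs where

open import Data.Nat using (ℕ; zero; suc; _+_; _≤_; _<_; _%_)
open import Data.Fin using (Fin; zero; suc; toℕ; inject₁; fromℕ; opposite)
open import Data.Product using (Σ; ∃; ∃₂; _×_; _,_)
open import Data.Sum using (_⊎_)
open import Data.Empty using (⊥)
open import Relation.Nullary using (¬_)
open import Relation.Binary.PropositionalEquality using (_≡_; _≢_)
open import Relation.Binary.Construct.Closure.Equivalence using (EqClosure)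
open import Function.Bundles using (_⇔_)
open import Function.Definitions using (Injective)

record Graph : Set₁ where
  field
    V : ℕ
    E : Fin V → Fin V → Set
open Graph public

record IsSimple (G : Graph) : Set where
  field
    sym     : ∀ {u v} → E G u v → E G v u
    irrefl  : ∀ {u} → ¬ E G u u

-- The cycle C_{2k+1}: vertices 0..2k, i ~ i±1 mod 2k+1

CycAdj : (k : ℕ) → Fin (suc (k + k)) → Fin (suc (k + k)) → Set
CycAdj k i j = (toℕ j ≡ suc (toℕ i) % suc (k + k))
             ⊎ (toℕ i ≡ suc (toℕ j) % suc (k + k))

Cycle : ℕ → Graph
Cycle k = record { V = suc (k + k) ; E = CycAdj k }

-- negation modulo p+1 on Fin (suc p)
negF : {p : ℕ} → Fin (suc p) → Fin (suc p)
negF zero    = zero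
negF (suc i) = suc (opposite i)

-- Cycles in G: a cycle of length p+1 (p ≥ 2) with consecutive vertices
-- c 0, c 1, ..., c p (distinct), c i ~ c (i+1), and c p ~ c 0.

record IsCycle (G : Graph) (p : ℕ) (c : Fin (suc p) → Fin (V G)) : Set where
  field
    long    : 2 ≤ p
    inj     : Injective _≡_ _≡_ c
    consec  : ∀ (i : Fin p) → E G (c (inject₁ i)) (c (suc i))
    closing : E G (c (fromℕ p)) (c zero)

record Instance (H : Graph) : Set₁ where
  constructor ⟨_,_⟩
  field
    G : Graph
    L : Fin (V G) → Fin (V H) → Set      -- L v x  means  x ∈ L(v)
open Instance public

IsListHom : {H : Graph} (I : Instance H) → (Fin (V (G I)) → Fin (V H)) → Set
IsListHom {H} I φ = (∀ v → L I v (φ v))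
                  × (∀ u v → E (G I) u v → E H (φ u) (φ v))

YesInstance : {H : Graph} → Instance H → Set
YesInstance I = ∃ λ φ → IsListHom I φ

data Outcome (H : Graph) : Set₁ where
  NO   : Outcome H
  inst : Instance H → Outcome H

removeL : {H : Graph} (I : Instance H) → Fin (V (G I)) → Fin (V H) → Instance H
removeL I u x = ⟨ G I , (λ w h → L I w h × ¬ (w ≡ u × h ≡ x)) ⟩

-- Identification: I' arises from I by identifying vertices along the
-- equivalence relation generated by R.

record Identification {H : Graph} (I : Instance H)
         (R : Fin (V (G I)) → Fin (V (G I)) → Set) (I' : Instance H) : Set where
  field
    q     : Fin (V (G I)) → Fin (V (G I'))
    surj  : ∀ a → ∃ λ x → q x ≡ a
    ker   : ∀ x y → (q x ≡ q y) ⇔ EqClosure R x y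
    adj   : ∀ a b → E (G I') a b ⇔ (∃₂ λ x y → q x ≡ a × q y ≡ b × E (G I) x y)
    lists : ∀ a h → L I' a h ⇔ (∀ x → q x ≡ a → L I x h)

-- The reduction rules (R1)–(R6) as a relation  Step H I o :
-- "applying a rule to I yields outcome o".

data Step : (H : Graph) → Instance H → Outcome H → Set₁ where
  R1    : ∀ {k} (I : Instance (Cycle k)) (r : ℕ) (c : Fin (suc (r + r)) → Fin (V (G I))) →
          1 ≤ r → r < k → IsCycle (G I) (r + r) c →
          Step (Cycle k) I NO
  R2a   : ∀ {k} (I : Instance (Cycle k)) (c c' : Fin (suc (k + k)) → Fin (V (G I)))
          (i j : Fin (suc (k + k))) (I' : Instance (Cycle k)) →
          IsCycle (G I) (k + k) c → IsCycle (G I) (k + k) c' →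
          c zero ≡ c' zero → i ≢ zero → j ≢ zero → c i ≡ c' j →
          i ≡ j →
          Identification I (λ x y → ∃ λ ℓ → x ≡ c ℓ × y ≡ c' ℓ) I' →
          Step (Cycle k) I (inst I')
  R2b   : ∀ {k} (I : Instance (Cycle k)) (c c' : Fin (suc (k + k)) → Fin (V (G I)))
          (i j : Fin (suc (k + k))) (I' : Instance (Cycle k)) →
          IsCycle (G I) (k + k) c → IsCycle (G I) (k + k) c' →
          c zero ≡ c' zero → i ≢ zero → j ≢ zero → c i ≡ c' j →
          i ≡ negF j →
          Identification I (λ x y → ∃ λ ℓ → x ≡ c ℓ × y ≡ c' (negF ℓ)) I' →
          Step (Cycle k) I (inst I')
  R2c   : ∀ {k} (I : Instance (Cycle k)) (c c' : Fin (suc (k + k)) → Fin (V (G I)))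
          (i j : Fin (suc (k + k))) →
          IsCycle (G I) (k + k) c → IsCycle (G I) (k + k) c' →
          c zero ≡ c' zero → i ≢ zero → j ≢ zero → c i ≡ c' j →
          i ≢ j → i ≢ negF j →
          Step (Cycle k) I NO
  R3    : ∀ {H} (I : Instance H) (u v : Fin (V (G I))) (x : Fin (V H)) →
          E (G I) u v → L I u x → (∀ y → E H x y → ¬ L I v y) →
          Step H I (inst (removeL I u x))
  R4    : ∀ {H} (I : Instance H) (v : Fin (V (G I))) →
          (∀ y → ¬ L I v y) →
          Step H I NO
  R5    : ∀ {H} (I : Instance H) (v : Fin (V (G I))) (x y : Fin (V H)) →
          x ≢ y → L I v x → L I v y →
          (∀ u → E (G I) v u → ∀ z → E H x z → L I u z → E H y z) →
          Step H I (inst (removeL I v x))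
  R6no  : ∀ {H} (I : Instance H) (x : Fin (V H)) (u v : Fin (V (G I))) →
          u ≢ v → (∀ h → L I u h ⇔ h ≡ x) → (∀ h → L I v h ⇔ h ≡ x) →
          E (G I) u v →
          Step H I NO
  R6id  : ∀ {H} (I : Instance H) (x : Fin (V H)) (u v : Fin (V (G I))) (I' : Instance H) →
          u ≢ v → (∀ h → L I u h ⇔ h ≡ x) → (∀ h → L I v h ⇔ h ≡ x) →
          ¬ E (G I) u v →
          Identification I (λ a b → a ≡ u × b ≡ v) I' →
          Step H I (inst I')

Sound : {H : Graph} → Instance H → Outcome H → Set
Sound I NO        = ¬ YesInstance I
Sound I (inst I') = YesInstance I' ⇔ YesInstance I

{-# OPTIONS --safe #-}
-- Rules (R3)-(R6) are sound by local surgery on list homomorphisms: a value removed by (R3) is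
-- unusable, a solution using the value x removed by (R5) can be redirected to the dominating y,
-- and every solution is constant on the classes identified by (R6).
--
-- Reading the vertices of C_{2k+1} as residues modulo 2k+1, a
-- homomorphic image of a closed walk of length m moves by +1 (U times) or -1 (W times), so
-- U + W = m and U ≡ W. For odd m < 2k+1 this forces U = W, contradicting parity: that is (R1).
-- For m = 2k+1 it forces U = 0 or W = 0, so the image of a (2k+1)-cycle c is a rotation
-- ℓ ↦ φ(c₀) ± ℓ. If two such rotations start at the same vertex and meet again at c_i = c'_j,
-- equal orientations force i = j and opposite ones force i = -j, and in each case the two cycles
-- are mapped exactly as the identification of (R2a) or (R2b) requires; otherwise (R2c) no
-- solution exists.
module Submission where

open import Defs

open import Data.Bool.Base using (if_then_else_)
open import Data.Fin.Base using (Fin; zero; suc; toℕ; inject₁; fromℕ; fromℕ<; opposite)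
open import Data.Fin.Properties
  using (toℕ-injective; toℕ<n; toℕ-fromℕ<; toℕ-fromℕ; toℕ-inject₁; opposite-prop; opposite-involutive)
  renaming (_≟_ to _≟ᶠ_)
open import Data.Nat.Base
  using (ℕ; zero; suc; _+_; _*_; _∸_; _≤_; _<_; _%_; s≤s; s≤s⁻¹; _≤′_; ≤′-refl; ≤′-step)
open import Data.Nat.DivMod
  using (_mod_; m%n<n; %-distribˡ-+; [m+kn]%n≡m%n; m<n⇒m%n≡m; m%n%n≡m%n; n%n≡0)
open import Data.Nat.Properties
  using (_≟_; ≤-refl; <⇒≤; ≤-trans; n≤1+n; ≤⇒≤′; m≤n⇒m<n∨m≡n; n≤0⇒n≡0; ≤-<-trans; <⇒≱; ≮⇒≥;
         m≤m+n; m≤n+m; m<m+n; m<n+m; n≢0⇒n>0; +-suc; +-comm; +-assoc; +-identityʳ; +-mono-<;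
         m+[n∸m]≡n; even≢odd)
open import Data.Nat.Tactic.RingSolver using (solve-∀)
open import Data.Product using (∃; _×_; _,_; proj₁; proj₂)
open import Data.Sum using (_⊎_; inj₁; inj₂)
import Data.Sum as Sum
open import Function.Base using (_∘_)
open import Function.Bundles using (_⇔_; mk⇔; Equivalence)
open import Level using (0ℓ)
open import Relation.Binary.Bundles using (Setoid)
open import Relation.Binary.Core using (_=[_]⇒_)
open import Relation.Binary.Structures using (IsEquivalence)
open import Relation.Binary.PropositionalEquality
import Relation.Binary.Reasoning.Setoid as ≈-Reasoning
open import Relation.Binary.Construct.Closure.Equivalence using (gfold)
open import Relation.Nullary using (¬_; Dec; yes; no; does; map′; ¬?; contradiction)
open import Relation.Unary using (Decidable)

count : {P : ℕ → Set} → Decidable P → ℕ → ℕ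
count P? zero    = 0
count P? (suc m) = if does (P? m) then suc (count P? m) else count P? m

module _ {P : ℕ → Set} (P? : Decidable P) where

  count-yes : ∀ {m} → P m → count P? (suc m) ≡ suc (count P? m)
  count-yes {m} Pm with P? m
  ... | yes _  = refl
  ... | no ¬Pm = contradiction Pm ¬Pm

  count-no : ∀ {m} → ¬ P m → count P? (suc m) ≡ count P? m
  count-no {m} ¬Pm with P? m
  ... | yes Pm = contradiction Pm ¬Pm
  ... | no _   = refl

  count-≤-suc : ∀ m → count P? m ≤ count P? (suc m)
  count-≤-suc m with P? m
  ... | yes _ = n≤1+n _
  ... | no _  = ≤-refl

  count-mono : ∀ {m m′} → m ≤ m′ → count P? m ≤ count P? m′
  count-mono = mono′ ∘ ≤⇒≤′
    where
    mono′ : ∀ {m m′} → m ≤′ m′ → count P? m ≤ count P? m′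
    mono′ ≤′-refl                       = ≤-refl
    mono′ {m′ = suc m′} (≤′-step m≤′m′) = ≤-trans (mono′ m≤′m′) (count-≤-suc m′)

  count+count-¬ : ∀ m → count P? m + count (¬? ∘ P?) m ≡ m
  count+count-¬ zero = refl
  count+count-¬ (suc m) with P? m
  ... | yes _ = cong suc (count+count-¬ m)
  ... | no _  = trans (+-suc _ _) (cong suc (count+count-¬ m))

m+m≢1+n+n : ∀ m n → m + m ≢ suc (n + n)
m+m≢1+n+n m n e = even≢odd m n (begin
  m + (m + 0)        ≡⟨ cong (m +_) (+-identityʳ m) ⟩
  m + m              ≡⟨ e ⟩
  suc (n + n)        ≡⟨ cong (λ t → suc (n + t)) (+-identityʳ n) ⟨
  suc (n + (n + 0))  ∎)
  where open ≡-Reasoning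

negF-involutive : ∀ {p} (i : Fin (suc p)) → negF (negF i) ≡ i
negF-involutive zero    = refl
negF-involutive (suc i) = cong suc (opposite-involutive i)

negF-injective : ∀ {p} {i j : Fin (suc p)} → negF i ≡ negF j → i ≡ j
negF-injective {i = i} {j} e = begin
  i               ≡⟨ negF-involutive i ⟨
  negF (negF i)   ≡⟨ cong negF e ⟩
  negF (negF j)   ≡⟨ negF-involutive j ⟩
  j               ∎
  where open ≡-Reasoning

toℕ-suc+negF : ∀ {p} (i : Fin p) → toℕ (suc i) + toℕ (negF (suc i)) ≡ suc p
toℕ-suc+negF {p} i = begin
  suc (toℕ i + suc (toℕ (opposite i)))   ≡⟨ cong suc (+-suc (toℕ i) _) ⟩
  suc (suc (toℕ i) + toℕ (opposite i))   ≡⟨ cong (λ t → suc (suc (toℕ i) + t)) (opposite-prop i) ⟩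
  suc (suc (toℕ i) + (p ∸ suc (toℕ i)))  ≡⟨ cong suc (m+[n∸m]≡n (toℕ<n i)) ⟩
  suc p                                  ∎
  where open ≡-Reasoning

negF-fixed⇒zero : ∀ {k} {j : Fin (suc (k + k))} → negF j ≡ j → j ≡ zero
negF-fixed⇒zero {j = zero}        _ = refl
negF-fixed⇒zero {k} {j = suc i} e =
  contradiction (trans (cong (λ t → toℕ (suc i) + toℕ t) (sym e)) (toℕ-suc+negF i))
                (m+m≢1+n+n (toℕ (suc i)) k)

module Modulo (p : ℕ) where

  -- A record rather than a bare equation of remainders, so that a and b can be inferred from a ≋ b.
  infix 4 _≋_
  record _≋_ (a b : ℕ) : Set where
    constructor mod-≡
    field %-≡ : a % suc p ≡ b % suc p
  open _≋_ public

  ≋-isEquivalence : IsEquivalence _≋_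
  ≋-isEquivalence = record
    { refl  = mod-≡ refl
    ; sym   = λ (mod-≡ e) → mod-≡ (sym e)
    ; trans = λ (mod-≡ e) (mod-≡ e′) → mod-≡ (trans e e′)
    }

  ≋-setoid : Setoid 0ℓ 0ℓ
  ≋-setoid = record { isEquivalence = ≋-isEquivalence }

  open IsEquivalence ≋-isEquivalence public
    using () renaming (refl to ≋-refl; sym to ≋-sym; trans to ≋-trans)

  ≋⇒≡ : ∀ {a b} → a < suc p → b < suc p → a ≋ b → a ≡ b
  ≋⇒≡ {a} {b} a<n b<n (mod-≡ e) = begin
    a           ≡⟨ m<n⇒m%n≡m a<n ⟨
    a % suc p   ≡⟨ e ⟩
    b % suc p   ≡⟨ m<n⇒m%n≡m b<n ⟩
    b           ∎
    where open ≡-Reasoning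

  ≡%⇒≋ : ∀ {a b} → a ≡ b % suc p → a ≋ b
  ≡%⇒≋ {b = b} refl = mod-≡ (m%n%n≡m%n b (suc p))

  suc-p≋0 : suc p ≋ 0
  suc-p≋0 = mod-≡ (n%n≡0 (suc p))

  ≋-+ˡ : ∀ c {a b} → a ≋ b → c + a ≋ c + b
  ≋-+ˡ c {a} {b} (mod-≡ e) = mod-≡ (begin
    (c + a) % suc p                 ≡⟨ %-distribˡ-+ c a (suc p) ⟩
    (c % suc p + a % suc p) % suc p ≡⟨ cong (λ t → (c % suc p + t) % suc p) e ⟩
    (c % suc p + b % suc p) % suc p ≡⟨ %-distribˡ-+ c b (suc p) ⟨
    (c + b) % suc p                 ∎)
    where open ≡-Reasoning

  ≋-+ʳ : ∀ c {a b} → a ≋ b → a + c ≋ b + c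
  ≋-+ʳ c {a} {b} e = subst₂ _≋_ (+-comm c a) (+-comm c b) (≋-+ˡ c e)

  ≋-cancelˡ : ∀ c {a b} → c + a ≋ c + b → a ≋ b
  ≋-cancelˡ c {a} {b} e = begin
    a                 ≈⟨ mod-≡ ([m+kn]%n≡m%n a c (suc p)) ⟨
    a + c * suc p     ≡⟨ inverse a c p ⟩
    c * p + (c + a)   ≈⟨ ≋-+ˡ (c * p) e ⟩
    c * p + (c + b)   ≡⟨ inverse b c p ⟨
    b + c * suc p     ≈⟨ mod-≡ ([m+kn]%n≡m%n b c (suc p)) ⟩
    b                 ∎
    where
    open ≈-Reasoning ≋-setoid
    -- c * p is an additive inverse of c modulo suc p.
    inverse : ∀ x c p → x + c * suc p ≡ c * p + (c + x)
    inverse = solve-∀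

  Adjacent : ℕ → ℕ → Set
  Adjacent a b = b ≋ suc a ⊎ a ≋ suc b

  module Walk (len : ℕ) (x : ℕ → ℕ) (steps : ∀ j → j < len → Adjacent (x j) (x (suc j))) where

    -- A step that is both forward and backward (possible only for p ≤ 1) counts as forward.
    forward? : ∀ j → Dec (x (suc j) ≋ suc (x j))
    forward? j = map′ mod-≡ %-≡ (x (suc j) % suc p ≟ suc (x j) % suc p)

    forwards backwards : ℕ → ℕ
    forwards  = count forward?
    backwards = count (¬? ∘ forward?)

    forwards+backwards : ∀ m → forwards m + backwards m ≡ m
    forwards+backwards = count+count-¬ forward?

    displacement : ∀ {m} → m ≤ len → x m + backwards m ≋ x 0 + forwards m
    displacement {zero}  _      = ≋-refl
    displacement {suc m} m<len with forward? m | steps m m<len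
    ... | yes f  | _      = begin
      x (suc m) + backwards (suc m) ≡⟨ cong (x (suc m) +_) (count-no (¬? ∘ forward?) (contradiction f)) ⟩
      x (suc m) + backwards m       ≈⟨ ≋-+ʳ (backwards m) f ⟩
      suc (x m + backwards m)       ≈⟨ ≋-+ˡ 1 (displacement (<⇒≤ m<len)) ⟩
      suc (x 0 + forwards m)        ≡⟨ +-suc (x 0) (forwards m) ⟨
      x 0 + suc (forwards m)        ≡⟨ cong (x 0 +_) (count-yes forward? f) ⟨
      x 0 + forwards (suc m)        ∎
      where open ≈-Reasoning ≋-setoid
    ... | no ¬f | inj₁ f = contradiction f ¬f
    ... | no ¬f | inj₂ b = begin
      x (suc m) + backwards (suc m) ≡⟨ cong (x (suc m) +_) (count-yes (¬? ∘ forward?) ¬f) ⟩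
      x (suc m) + suc (backwards m) ≡⟨ +-suc (x (suc m)) (backwards m) ⟩
      suc (x (suc m)) + backwards m ≈⟨ ≋-+ʳ (backwards m) b ⟨
      x m + backwards m             ≈⟨ displacement (<⇒≤ m<len) ⟩
      x 0 + forwards m              ≡⟨ cong (x 0 +_) (count-no forward? ¬f) ⟨
      x 0 + forwards (suc m)        ∎
      where open ≈-Reasoning ≋-setoid

    all-forward : backwards len ≡ 0 → ∀ {m} → m ≤ len → x m ≋ x 0 + m
    all-forward none {m} m≤len = begin
      x m                 ≡⟨ +-identityʳ (x m) ⟨
      x m + 0             ≡⟨ cong (x m +_) W≡0 ⟨
      x m + backwards m   ≈⟨ displacement m≤len ⟩
      x 0 + forwards m    ≡⟨ cong (x 0 +_) U≡m ⟩
      x 0 + m             ∎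
      where
      open ≈-Reasoning ≋-setoid
      W≡0 : backwards m ≡ 0
      W≡0 = n≤0⇒n≡0 (subst (backwards m ≤_) none (count-mono (¬? ∘ forward?) m≤len))
      U≡m : forwards m ≡ m
      U≡m = trans (sym (+-identityʳ _)) (subst (λ t → forwards m + t ≡ m) W≡0 (forwards+backwards m))

    all-backward : forwards len ≡ 0 → ∀ {m} → m ≤ len → x m + m ≋ x 0
    all-backward none {m} m≤len = begin
      x m + m             ≡⟨ cong (x m +_) W≡m ⟨
      x m + backwards m   ≈⟨ displacement m≤len ⟩
      x 0 + forwards m    ≡⟨ cong (x 0 +_) U≡0 ⟩
      x 0 + 0             ≡⟨ +-identityʳ (x 0) ⟩
      x 0                 ∎
      where
      open ≈-Reasoning ≋-setoid
      U≡0 : forwards m ≡ 0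
      U≡0 = n≤0⇒n≡0 (subst (forwards m ≤_) none (count-mono forward? m≤len))
      W≡m : backwards m ≡ m
      W≡m = subst (λ t → t + backwards m ≡ m) U≡0 (forwards+backwards m)

    module _ (closed : x len ≡ x 0) where

      backwards≋forwards : backwards len ≋ forwards len
      backwards≋forwards = ≋-cancelˡ (x 0)
        (subst (λ t → t + backwards len ≋ x 0 + forwards len) closed (displacement ≤-refl))

      len≡forwards+forwards : forwards len < suc p → backwards len < suc p →
                              len ≡ forwards len + forwards len
      len≡forwards+forwards U<n W<n = begin
        len                          ≡⟨ forwards+backwards len ⟨
        forwards len + backwards len ≡⟨ cong (forwards len +_) (≋⇒≡ W<n U<n backwards≋forwards) ⟩
        forwards len + forwards len  ∎
        where open ≡-Reasoning

      odd⇒suc-p≤len : ∀ {r} → len ≡ suc (r + r) → suc p ≤ len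
      odd⇒suc-p≤len {r} odd = ≮⇒≥ λ len<n → m+m≢1+n+n (forwards len) r
        (trans (sym (len≡forwards+forwards (≤-<-trans U≤len len<n) (≤-<-trans W≤len len<n))) odd)
        where
        U≤len : forwards len ≤ len
        U≤len = subst (forwards len ≤_) (forwards+backwards len) (m≤m+n _ _)
        W≤len : backwards len ≤ len
        W≤len = subst (backwards len ≤_) (forwards+backwards len) (m≤n+m _ _)

      backwards≡0⊎forwards≡0 : ∀ {r} → p ≡ r + r → len ≡ suc p →
                               backwards len ≡ 0 ⊎ forwards len ≡ 0
      backwards≡0⊎forwards≡0 {r} p≡r+r len≡n with backwards len ≟ 0 | forwards len ≟ 0
      ... | yes W≡0 | _       = inj₁ W≡0
      ... | no _    | yes U≡0 = inj₂ U≡0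
      ... | no W≢0  | no U≢0  = contradiction
        (trans (sym (len≡forwards+forwards U<n W<n)) (trans len≡n (cong suc p≡r+r)))
        (m+m≢1+n+n (forwards len) r)
        where
        U+W≡n : forwards len + backwards len ≡ suc p
        U+W≡n = trans (forwards+backwards len) len≡n
        U<n : forwards len < suc p
        U<n = subst (forwards len <_) U+W≡n (m<m+n _ (n≢0⇒n>0 W≢0))
        W<n : backwards len < suc p
        W<n = subst (backwards len <_) U+W≡n (m<n+m _ (n≢0⇒n>0 U≢0))

  toℕ-mod : ∀ m → toℕ (m mod suc p) ≋ m
  toℕ-mod m = ≡%⇒≋ (toℕ-fromℕ< (m%n<n m (suc p)))

  toℕ-≋-injective : ∀ {i j : Fin (suc p)} → toℕ i ≋ toℕ j → i ≡ j
  toℕ-≋-injective {i} {j} e = toℕ-injective (≋⇒≡ (toℕ<n i) (toℕ<n j) e)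

  infixl 6 _⊕_
  _⊕_ : Fin (suc p) → Fin (suc p) → Fin (suc p)
  a ⊕ t = (toℕ a + toℕ t) mod suc p

  ≋⇒≡-⊕ : ∀ {w} a t → toℕ w ≋ toℕ a + toℕ t → w ≡ a ⊕ t
  ≋⇒≡-⊕ a t e = toℕ-≋-injective (≋-trans e (≋-sym (toℕ-mod _)))

  ⊕-cancelˡ : ∀ a {s t} → a ⊕ s ≡ a ⊕ t → s ≡ t
  ⊕-cancelˡ a {s} {t} e = toℕ-≋-injective (≋-cancelˡ (toℕ a) (begin
    toℕ a + toℕ s  ≈⟨ toℕ-mod _ ⟨
    toℕ (a ⊕ s)    ≡⟨ cong toℕ e ⟩
    toℕ (a ⊕ t)    ≈⟨ toℕ-mod _ ⟩
    toℕ a + toℕ t  ∎))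
    where open ≈-Reasoning ≋-setoid

  toℕ+toℕ-negF : ∀ (ℓ : Fin (suc p)) → toℕ ℓ + toℕ (negF ℓ) ≋ 0
  toℕ+toℕ-negF zero    = ≋-refl
  toℕ+toℕ-negF (suc i) = subst (_≋ 0) (sym (toℕ-suc+negF i)) suc-p≋0

  +toℕ-≋⇒≋+negF : ∀ {a b} (ℓ : Fin (suc p)) → a + toℕ ℓ ≋ b → a ≋ b + toℕ (negF ℓ)
  +toℕ-≋⇒≋+negF {a} {b} ℓ e = begin
    a                              ≡⟨ +-identityʳ a ⟨
    a + 0                          ≈⟨ ≋-+ˡ a (toℕ+toℕ-negF ℓ) ⟨
    a + (toℕ ℓ + toℕ (negF ℓ))     ≡⟨ +-assoc a (toℕ ℓ) _ ⟨
    a + toℕ ℓ + toℕ (negF ℓ)       ≈⟨ ≋-+ʳ (toℕ (negF ℓ)) e ⟩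
    b + toℕ (negF ℓ)               ∎
    where open ≈-Reasoning ≋-setoid

record IsClosedWalk (H : Graph) (L : ℕ) (w : Fin (suc L) → Fin (V H)) : Set where
  field
    consec  : ∀ (i : Fin L) → E H (w (inject₁ i)) (w (suc i))
    closing : E H (w (fromℕ L)) (w zero)

cycle-image : ∀ {G H L c} {φ : Fin (V G) → Fin (V H)} → IsCycle G L c →
              (∀ u v → E G u v → E H (φ u) (φ v)) → IsClosedWalk H L (φ ∘ c)
cycle-image cyc hom = record
  { consec  = λ i → hom _ _ (IsCycle.consec cyc i)
  ; closing = hom _ _ (IsCycle.closing cyc)
  }

module _ {k : ℕ} where
  open Modulo (k + k)

  CycAdj⇒Adjacent : ∀ {a b} → CycAdj k a b → Adjacent (toℕ a) (toℕ b)
  CycAdj⇒Adjacent = Sum.map ≡%⇒≋ ≡%⇒≋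

  module Trace {L} {w : Fin (suc L) → Fin (suc (k + k))} (walk : IsClosedWalk (Cycle k) L w) where

    -- Indices are read modulo suc L, so that the trace returns to w zero after suc L steps.
    trace : ℕ → ℕ
    trace j = toℕ (w (j mod suc L))

    trace-at : ∀ ℓ {j} → toℕ ℓ ≡ j → trace j ≡ toℕ (w ℓ)
    trace-at ℓ refl = cong (toℕ ∘ w) (toℕ-injective (trans (toℕ-fromℕ< _) (m<n⇒m%n≡m (toℕ<n ℓ))))

    trace-closes : trace (suc L) ≡ toℕ (w zero)
    trace-closes = cong (toℕ ∘ w) (toℕ-injective (trans (toℕ-fromℕ< _) (n%n≡0 (suc L))))

    trace-steps : ∀ j → j < suc L → Adjacent (trace j) (trace (suc j))
    trace-steps j j<len with m≤n⇒m<n∨m≡n (s≤s⁻¹ j<len)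
    ... | inj₁ j<L = subst₂ Adjacent
      (sym (trace-at (inject₁ i) (trans (toℕ-inject₁ i) (toℕ-fromℕ< j<L))))
      (sym (trace-at (suc i) (cong suc (toℕ-fromℕ< j<L))))
      (CycAdj⇒Adjacent (IsClosedWalk.consec walk i))
      where i = fromℕ< j<L
    ... | inj₂ refl = subst₂ Adjacent
      (sym (trace-at (fromℕ L) (toℕ-fromℕ L)))
      (sym trace-closes)
      (CycAdj⇒Adjacent (IsClosedWalk.closing walk))

    open Walk (suc L) trace trace-steps public

  no-short-odd-closed-walk : ∀ {r w} → r < k → ¬ IsClosedWalk (Cycle k) (r + r) w
  no-short-odd-closed-walk {r} r<k walk =
    <⇒≱ (s≤s (+-mono-< r<k r<k)) (odd⇒suc-p≤len trace-closes {r} refl)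
    where open Trace walk

  closed-walk-rotation : ∀ {w} → IsClosedWalk (Cycle k) (k + k) w →
    (∀ ℓ → w ℓ ≡ w zero ⊕ ℓ) ⊎ (∀ ℓ → w ℓ ≡ w zero ⊕ negF ℓ)
  closed-walk-rotation {w} walk =
    Sum.map forward backward (backwards≡0⊎forwards≡0 trace-closes {k} refl refl)
    where
    open Trace walk
    forward : backwards (suc (k + k)) ≡ 0 → ∀ ℓ → w ℓ ≡ w zero ⊕ ℓ
    forward W≡0 ℓ = ≋⇒≡-⊕ (w zero) ℓ
      (subst (_≋ toℕ (w zero) + toℕ ℓ) (trace-at ℓ refl) (all-forward W≡0 (<⇒≤ (toℕ<n ℓ))))
    backward : forwards (suc (k + k)) ≡ 0 → ∀ ℓ → w ℓ ≡ w zero ⊕ negF ℓ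
    backward U≡0 ℓ = ≋⇒≡-⊕ (w zero) (negF ℓ) (+toℕ-≋⇒≋+negF ℓ
      (subst (λ t → t + toℕ ℓ ≋ toℕ (w zero)) (trace-at ℓ refl) (all-backward U≡0 (<⇒≤ (toℕ<n ℓ)))))

  module Meeting {w w′ : Fin (suc (k + k)) → Fin (suc (k + k))} {i j}
                 (walk : IsClosedWalk (Cycle k) (k + k) w)
                 (walk′ : IsClosedWalk (Cycle k) (k + k) w′)
                 (w0≡w′0 : w zero ≡ w′ zero) (wi≡w′j : w i ≡ w′ j) where

    module _ {σ σ′ : Fin (suc (k + k)) → Fin (suc (k + k))}
             (r : ∀ ℓ → w ℓ ≡ w zero ⊕ σ ℓ) (r′ : ∀ ℓ → w′ ℓ ≡ w′ zero ⊕ σ′ ℓ) where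

      indices : σ i ≡ σ′ j
      indices = ⊕-cancelˡ (w zero) (begin
        w zero ⊕ σ i    ≡⟨ r i ⟨
        w i             ≡⟨ wi≡w′j ⟩
        w′ j            ≡⟨ r′ j ⟩
        w′ zero ⊕ σ′ j  ≡⟨ cong (_⊕ σ′ j) w0≡w′0 ⟨
        w zero ⊕ σ′ j   ∎)
        where open ≡-Reasoning

      values : ∀ {ℓ ℓ′} → σ ℓ ≡ σ′ ℓ′ → w ℓ ≡ w′ ℓ′
      values e = trans (r _) (trans (cong₂ _⊕_ w0≡w′0 e) (sym (r′ _)))

    meet : (i ≡ j × ∀ ℓ → w ℓ ≡ w′ ℓ) ⊎ (i ≡ negF j × ∀ ℓ → w ℓ ≡ w′ (negF ℓ))
    meet with closed-walk-rotation walk | closed-walk-rotation walk′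
    ... | inj₁ r | inj₁ r′ = inj₁ (indices r r′ , λ ℓ → values r r′ refl)
    ... | inj₂ r | inj₂ r′ = inj₁ (negF-injective (indices r r′) , λ ℓ → values r r′ refl)
    ... | inj₁ r | inj₂ r′ = inj₂ (indices r r′ , λ ℓ → values r r′ (sym (negF-involutive ℓ)))
    ... | inj₂ r | inj₁ r′ =
      inj₂ (trans (sym (negF-involutive i)) (cong negF (indices r r′)) , λ ℓ → values r r′ refl)

    aligned : i ≡ j → j ≢ zero → ∀ ℓ → w ℓ ≡ w′ ℓ
    aligned i≡j j≢0 with meet
    ... | inj₁ (_ , w≡w′)   = w≡w′
    ... | inj₂ (i≡negFj , _) = contradiction (negF-fixed⇒zero {k} (trans (sym i≡negFj) i≡j)) j≢0

    opposed : i ≡ negF j → j ≢ zero → ∀ ℓ → w ℓ ≡ w′ (negF ℓ)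
    opposed i≡negFj j≢0 with meet
    ... | inj₁ (i≡j , _)    = contradiction (negF-fixed⇒zero {k} (trans (sym i≡negFj) i≡j)) j≢0
    ... | inj₂ (_ , w≡w′∘negF) = w≡w′∘negF

    meeting-index : i ≡ j ⊎ i ≡ negF j
    meeting-index = Sum.map proj₁ proj₁ meet

module _ {H : Graph} {I I′ : Instance H} {R : Fin (V (G I)) → Fin (V (G I)) → Set}
         (idn : Identification I R I′) where
  open Identification idn

  identification-sound : (∀ {φ} → IsListHom I φ → R =[ φ ]⇒ _≡_) → YesInstance I′ ⇔ YesInstance I
  identification-sound respects = mk⇔ pull push
    where
    pull : YesInstance I′ → YesInstance I
    pull (ψ , inL , hom) =
      ψ ∘ q ,
      (λ x → Equivalence.to (lists (q x) (ψ (q x))) (inL (q x)) x refl) ,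
      (λ x y e → hom (q x) (q y) (Equivalence.from (adj (q x) (q y)) (x , y , refl , refl , e)))

    push : YesInstance I → YesInstance I′
    push (φ , inL , hom) = φ ∘ representative , inL′ , hom′
      where
      representative : Fin (V (G I′)) → Fin (V (G I))
      representative a = proj₁ (surj a)
      φ-constant : ∀ {x a} → q x ≡ a → φ x ≡ φ (representative a)
      φ-constant {x} {a} qx≡a = gfold isEquivalence φ (respects (inL , hom))
        (Equivalence.to (ker x (representative a)) (trans qx≡a (sym (proj₂ (surj a)))))
      inL′ : ∀ a → L I′ a (φ (representative a))
      inL′ a = Equivalence.from (lists a _) λ x qx≡a → subst (L I x) (φ-constant qx≡a) (inL x)
      hom′ : ∀ a b → E (G I′) a b → E H (φ (representative a)) (φ (representative b))
      hom′ a b e with Equivalence.to (adj a b) e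
      ... | x , y , qx≡a , qy≡b , xy = subst₂ (E H) (φ-constant qx≡a) (φ-constant qy≡b) (hom x y xy)

module _ {H : Graph} (I : Instance H) where

  removeL-sound : ∀ {u x} → (YesInstance I → YesInstance (removeL I u x)) →
                  YesInstance (removeL I u x) ⇔ YesInstance I
  removeL-sound = mk⇔ λ (φ , inL , hom) → φ , proj₁ ∘ inL , hom

  removeL-hom : ∀ {φ u x} → IsListHom I φ → φ u ≢ x → IsListHom (removeL I u x) φ
  removeL-hom (inL , hom) φu≢x = (λ w → inL w , λ { (refl , φw≡x) → φu≢x φw≡x }) , hom

  removeL-unsupported : ∀ {u v x} → E (G I) u v → (∀ y → E H x y → ¬ L I v y) →
                        YesInstance I → YesInstance (removeL I u x)
  removeL-unsupported {u} {v} uv unsupported (φ , inL , hom) = φ , removeL-hom (inL , hom)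
    λ φu≡x → unsupported (φ v) (subst (λ t → E H t (φ v)) φu≡x (hom u v uv)) (inL v)

  redirect-dominated : IsSimple H → IsSimple (G I) → ∀ {v x y} → L I v y →
    (∀ u → E (G I) v u → ∀ z → E H x z → L I u z → E H y z) →
    ∀ {φ} → IsListHom I φ → φ v ≡ x → ∃ λ ψ → IsListHom I ψ × ψ v ≡ y
  redirect-dominated simpleH simpleG {v} {x} {y} Lvy dominated {φ} (inL , hom) φv≡x =
    ψ , (inL′ , hom′) , ψv≡y
    where
    ψ : Fin (V (G I)) → Fin (V H)
    ψ w with w ≟ᶠ v
    ... | yes _ = y
    ... | no _  = φ w

    ψv≡y : ψ v ≡ y
    ψv≡y with v ≟ᶠ v
    ... | yes _   = refl
    ... | no v≢v = contradiction refl v≢v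

    inL′ : ∀ w → L I w (ψ w)
    inL′ w with w ≟ᶠ v
    ... | yes refl = Lvy
    ... | no _     = inL w

    toward-v : ∀ {u} → E (G I) v u → E H y (φ u)
    toward-v {u} vu = dominated u vu (φ u) (subst (λ t → E H t (φ u)) φv≡x (hom v u vu)) (inL u)

    hom′ : ∀ a b → E (G I) a b → E H (ψ a) (ψ b)
    hom′ a b ab with a ≟ᶠ v | b ≟ᶠ v
    ... | yes refl | yes refl = contradiction ab (IsSimple.irrefl simpleG)
    ... | yes refl | no _     = toward-v ab
    ... | no _     | yes refl = IsSimple.sym simpleH (toward-v (IsSimple.sym simpleG ab))
    ... | no _     | no _     = hom a b ab

  removeL-dominated : IsSimple H → IsSimple (G I) → ∀ {v x y} → x ≢ y → L I v y →
    (∀ u → E (G I) v u → ∀ z → E H x z → L I u z → E H y z) →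
    YesInstance I → YesInstance (removeL I v x)
  removeL-dominated simpleH simpleG {v} {x} x≢y Lvy dominated (φ , φ-hom) with φ v ≟ᶠ x
  ... | no φv≢x  = φ , removeL-hom φ-hom φv≢x
  ... | yes φv≡x with redirect-dominated simpleH simpleG Lvy dominated φ-hom φv≡x
  ...   | ψ , ψ-hom , ψv≡y = ψ , removeL-hom ψ-hom λ ψv≡x → x≢y (trans (sym ψv≡x) ψv≡y)

lemma2 : (H : Graph) (I : Instance H) (o : Outcome H) →
         IsSimple H → IsSimple (G I) →
         Step H I o → Sound I o
lemma2 _ _ _ _ _ (R1 {k} _ r c _ r<k cyc) (φ , _ , hom) =
  no-short-odd-closed-walk {k} r<k (cycle-image cyc hom)
lemma2 _ _ _ _ _ (R2a {k} _ c c′ i j I′ cyc cyc′ c0≡c′0 _ j≢0 ci≡c′j i≡j idn) =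
  identification-sound idn λ {φ} (_ , hom) → λ { (ℓ , refl , refl) →
    Meeting.aligned {k} (cycle-image cyc hom) (cycle-image cyc′ hom) (cong φ c0≡c′0) (cong φ ci≡c′j)
      i≡j j≢0 ℓ }
lemma2 _ _ _ _ _ (R2b {k} _ c c′ i j I′ cyc cyc′ c0≡c′0 _ j≢0 ci≡c′j i≡negFj idn) =
  identification-sound idn λ {φ} (_ , hom) → λ { (ℓ , refl , refl) →
    Meeting.opposed {k} (cycle-image cyc hom) (cycle-image cyc′ hom) (cong φ c0≡c′0) (cong φ ci≡c′j)
      i≡negFj j≢0 ℓ }
lemma2 _ _ _ _ _ (R2c {k} _ c c′ i j cyc cyc′ c0≡c′0 _ _ ci≡c′j i≢j i≢negFj) (φ , _ , hom) =
  Sum.[ i≢j , i≢negFj ]′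
    (Meeting.meeting-index {k} (cycle-image cyc hom) (cycle-image cyc′ hom)
      (cong φ c0≡c′0) (cong φ ci≡c′j))
lemma2 _ I _ _ _ (R3 _ u v x uv _ unsupported) =
  removeL-sound I (removeL-unsupported I uv unsupported)
lemma2 _ _ _ _ _ (R4 _ v empty) (φ , inL , _) = empty (φ v) (inL v)
lemma2 _ I _ simpleH simpleG (R5 _ v x y x≢y _ Lvy dominated) =
  removeL-sound I (removeL-dominated I simpleH simpleG x≢y Lvy dominated)
lemma2 H _ _ simpleH _ (R6no _ x u v _ Lu≡x Lv≡x uv) (φ , inL , hom) =
  IsSimple.irrefl simpleH
    (subst₂ (E H) (Equivalence.to (Lu≡x (φ u)) (inL u)) (Equivalence.to (Lv≡x (φ v)) (inL v))
      (hom u v uv))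
lemma2 _ _ _ _ _ (R6id _ x u v I′ _ Lu≡x Lv≡x _ idn) =
  identification-sound idn λ {φ} (inL , _) → λ { (refl , refl) →
    trans (Equivalence.to (Lu≡x (φ u)) (inL u)) (sym (Equivalence.to (Lv≡x (φ v)) (inL v))) }
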